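{- Let $Y$ be a generalized truncation of a multigraph $X$. Then $Y$ is connected if and only if the projection of $Y$ into $\hat{X}$ is connected.
   Context: A multigraph may have multiple edges but no loops; it is assumed to have no isolated vertices. Generalized truncation: take a matching $M_0$ with $|M_0|=|E(X)|$ (on $2|E(X)|$ new vertices) and a bijection $F:E(X)\to M_0$; for each edge $e$ of $X$ with ends $u,v$, label one end of $F(e)$ by $u$ and the other by $v$. For $v\in V(X)$, the cluster $\mathrm{cl}(v)$ is the set of vertices labelled $v$; insert an arbitrary graph $\mathrm{con}(v)$ (constituent) on $\mathrm{cl}(v)$. The graph $Y=F(M_0)\cup\bigcup_v\mathrm{con}(v)$ is a generalized truncation of $X$. The auxiliary graph $\hat{X}$: its vertices are the edges of $F(M_0)$ (equivalently, obtained by contracting each edge of $F(M_0)$ to a vertex), each labelled by the 2-set $\{u,v\}$ of labels of the ends of that edge; two distinct vertices of $\hat{X}$ are adjacent iff their label sets have nonempty intersection. The projection of $Y$ into $\hat{X}$ is the spanning subgraph of $\hat{X}$ in which two vertices (i.e. two edges $f,g$ of $F(M_0)$) are adjacent iff $Y$ has an edge joining an end of $f$ to an end of $g$. -}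

module Defs where

open import Data.Nat using (ℕ)
open import Data.Fin using (Fin)
open import Data.Bool using (Bool; true; false)
open import Data.Product using (Σ; ∃; _×_; _,_; proj₁; proj₂)
open import Data.Sum using (_⊎_)
open import Relation.Nullary using (¬_)
open import Relation.Binary.PropositionalEquality using (_≡_; _≢_)
open import Relation.Binary.Construct.Closure.ReflexiveTransitive using (Star)
open import Relation.Binary.Construct.Closure.Symmetric using (SymClosure)

record Graph (V : Set) : Set₁ where
  field
    Adj     : V → V → Set
    sym     : ∀ {x y} → Adj x y → Adj y x
    irrefl  : ∀ {x} → ¬ Adj x x
open Graph public

Connected : {V : Set} → (V → V → Set) → Set
Connected {V} R = (x y : V) → Star (SymClosure R) x y

record Multigraph : Set where
  field
    nV   : ℕ
    nE   : ℕ
    ends : Fin nE → Fin nV × Fin nV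
    noLoop     : ∀ e → proj₁ (ends e) ≢ proj₂ (ends e)
    noIsolated : ∀ v → ∃ λ e → (proj₁ (ends e) ≡ v) ⊎ (proj₂ (ends e) ≡ v)
open Multigraph public

module _ (X : Multigraph) where

  -- Vertices of the matching F(M0): the two ends (false/true) of the
  -- matching edge F(e), for each edge e of X.
  TVert : Set
  TVert = Fin (nE X) × Bool

  label : TVert → Fin (nV X)
  label (e , false) = proj₁ (ends X e)
  label (e , true)  = proj₂ (ends X e)

  Cluster : Fin (nV X) → Set
  Cluster v = Σ TVert λ x → label x ≡ v

  -- Label set {u,v} of a vertex of X̂ (an edge of F(M0)) contains w.
  _∈lab_ : Fin (nV X) → Fin (nE X) → Set
  w ∈lab f = (proj₁ (ends X f) ≡ w) ⊎ (proj₂ (ends X f) ≡ w)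

  XhatAdj : Fin (nE X) → Fin (nE X) → Set
  XhatAdj f g = f ≢ g × ∃ λ w → w ∈lab f × w ∈lab g

record GenTruncation (X : Multigraph) : Set₁ where
  field
    con : (v : Fin (nV X)) → Graph (Cluster X v)
open GenTruncation public

module _ {X : Multigraph} (T : GenTruncation X) where

  -- Adjacency in Y = F(M0) ∪ ⋃_v con(v).
  YAdj : TVert X → TVert X → Set
  YAdj x y =
      (proj₁ x ≡ proj₁ y × proj₂ x ≢ proj₂ y)
    ⊎ (Σ (Fin (nV X)) λ v → Σ (label X x ≡ v) λ px → Σ (label X y ≡ v) λ py →
         Adj (con T v) (x , px) (y , py))

  ProjAdj : Fin (nE X) → Fin (nE X) → Set
  ProjAdj f g = XhatAdj X f g × ∃ λ b → ∃ λ b' → YAdj (f , b) (g , b')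

-- The contraction of the matching edges maps Y onto X̂, and that map sends
-- Y-edges inside a matching edge to nothing and Y-edges between two matching
-- edges exactly to the edges of the projection. Hence walks of Y push forward
-- to walks of the projection; conversely a walk of the projection lifts to Y
-- because every edge of the projection comes from a Y-edge and the two ends
-- of each matching edge are adjacent in Y.
module Submission where

open import Defs hiding (sym)
open import Data.Bool using (true; false) renaming (_≟_ to _≟ᵇ_)
open import Data.Fin using () renaming (_≟_ to _≟ᶠ_)
open import Data.Product using (∃₂; _×_; _,_; proj₁; proj₂)
open import Data.Sum using (inj₁; inj₂)
open import Level using (0ℓ)
open import Function.Bundles using (_⇔_; mk⇔)
open import Relation.Binary.Core using (Rel; _=[_]⇒_)
open import Relation.Binary.Construct.Closure.ReflexiveTransitive
  using (Star; ε; _◅_; _◅◅_; kleisliStar; reverse)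
open import Relation.Binary.Construct.Closure.Symmetric
  using (SymClosure; fwd; bwd; symmetric; gfold)
open import Relation.Nullary using (yes; no)
open import Relation.Binary.PropositionalEquality using (_≡_; refl; sym; trans)

module _ {A B : Set} {R : Rel A 0ℓ} {S : Rel B 0ℓ} (p : A → B) where

  walk-image : R =[ p ]⇒ Star (SymClosure S) →
               Star (SymClosure R) =[ p ]⇒ Star (SymClosure S)
  walk-image step =
    kleisliStar p (gfold {S = Star (SymClosure S)} (reverse (symmetric S)) p step)

  connected-image : (s : B → A) → (∀ b → p (s b) ≡ b) →
                    R =[ p ]⇒ Star (SymClosure S) → Connected R → Connected S
  connected-image s p∘s≡id step conn b c
    rewrite sym (p∘s≡id b) | sym (p∘s≡id c) = walk-image step (conn (s b) (s c))

  module _ (fibre : ∀ {x y} → p x ≡ p y → Star (SymClosure R) x y)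
           (lift : ∀ {b c} → S b c → ∃₂ λ x y → p x ≡ b × p y ≡ c × R x y) where

    walk-lift : ∀ {b c} → Star (SymClosure S) b c →
                ∀ x y → p x ≡ b → p y ≡ c → Star (SymClosure R) x y
    walk-lift ε x y px py = fibre (trans px (sym py))
    walk-lift (fwd s ◅ w) x y px py with lift s
    ... | x′ , y′ , px′ , py′ , r =
      fibre (trans px (sym px′)) ◅◅ fwd r ◅ walk-lift w y′ y py′ py
    walk-lift (bwd s ◅ w) x y px py with lift s
    ... | y′ , x′ , py′ , px′ , r =
      fibre (trans px (sym px′)) ◅◅ bwd r ◅ walk-lift w y′ y py′ py

    connected-preimage : Connected S → Connected R
    connected-preimage conn x y = walk-lift (conn (p x) (p y)) x y refl refl

module _ {X : Multigraph} (T : GenTruncation X) where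

  label-∈lab : (x : TVert X) → _∈lab_ X (label X x) (proj₁ x)
  label-∈lab (e , false) = inj₁ refl
  label-∈lab (e , true)  = inj₂ refl

  YAdj⇒projection-walk : YAdj T =[ proj₁ ]⇒ Star (SymClosure (ProjAdj T))
  YAdj⇒projection-walk (inj₁ (refl , _)) = ε
  YAdj⇒projection-walk {e , b} {f , c} a@(inj₂ (_ , refl , py , _)) with e ≟ᶠ f
  ... | yes refl = ε
  ... | no e≢f   = fwd ((e≢f , _ , label-∈lab (e , b) , subst-∈lab py) , b , c , a) ◅ ε
    where
    subst-∈lab : ∀ {v} → label X (f , c) ≡ v → _∈lab_ X v f
    subst-∈lab refl = label-∈lab (f , c)

  matching-ends-joined : ∀ {x y : TVert X} → proj₁ x ≡ proj₁ y →
                         Star (SymClosure (YAdj T)) x y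
  matching-ends-joined {e , b} {.e , c} refl with b ≟ᵇ c
  ... | yes refl = ε
  ... | no b≢c   = fwd (inj₁ (refl , b≢c)) ◅ ε

  ProjAdj-lift : ∀ {f g} → ProjAdj T f g →
                 ∃₂ λ x y → proj₁ x ≡ f × proj₁ y ≡ g × YAdj T x y
  ProjAdj-lift {f} {g} (_ , b , c , a) = (f , b) , (g , c) , refl , refl , a

theorem3p1 : (X : Multigraph) (T : GenTruncation X) →
    Connected (YAdj T) ⇔ Connected (ProjAdj T)
theorem3p1 X T = mk⇔
  (connected-image proj₁ (λ e → e , false) (λ _ → refl) (YAdj⇒projection-walk T))
  (connected-preimage proj₁ (matching-ends-joined T) (ProjAdj-lift T))
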